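{- (a) If $k\ge 2$, then the complete bipartite graph $K_{2,k}$ is ${\cal D}$-minimal. (b) If $k\ge 1$, then $P_2\,\square\, C_{2k+1}$ is ${\cal D}$-minimal.
   Context: The Maker-Breaker total domination game on a graph $G$ is played by Dominator and Staller, who alternately select a vertex of $G$ not selected before. Dominator wins if at some point the set of vertices he has selected is a total dominating set of $G$ (every vertex has a neighbour in it); otherwise Staller wins. A graph is ${\cal D}$ if Dominator has a winning strategy both when he moves first and when Staller moves first. A connected graph $G$ is ${\cal D}$-minimal if $G$ is ${\cal D}$ but $G-e$ is not ${\cal D}$ for every edge $e\in E(G)$. -}

module Defs where

open import Data.Nat using (ℕ; suc; _*_; _<_; _%_; NonZero)
open import Data.Fin using (Fin; toℕ; remQuot)
open import Data.Fin.Subset using (Subset; _∈_; _∉_; _∪_; ⁅_⁆; ⊥)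
open import Data.Product using (Σ; ∃; _×_; _,_; proj₁; proj₂)
open import Data.Sum using (_⊎_)
open import Relation.Nullary using (¬_)
open import Relation.Binary.PropositionalEquality using (_≡_; _≢_)

-- A (finite, simple) graph on the vertex set Fin n, given by its adjacency
-- relation.  All concrete graphs below are loopless and symmetric.
Graph : ℕ → Set₁
Graph n = Fin n → Fin n → Set

removeEdge : ∀ {n} → Graph n → Fin n → Fin n → Graph n
removeEdge G u v x y = G x y × ¬ ((x ≡ u × y ≡ v) ⊎ (x ≡ v × y ≡ u))

data Reach {n} (G : Graph n) (x : Fin n) : Fin n → Set where
  here : Reach G x x
  step : ∀ {y z} → Reach G x y → G y z → Reach G x z

Connected : ∀ {n} → Graph n → Set
Connected G = ∀ x y → Reach G x y

TotalDominating : ∀ {n} → Graph n → Subset n → Set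
TotalDominating G D = ∀ v → ∃ λ u → u ∈ D × G u v

Free : ∀ {n} → Subset n → Subset n → Fin n → Set
Free D S v = v ∉ D × v ∉ S

-- Positions of the Maker-Breaker total domination game: D = vertices
-- selected by Dominator, S = vertices selected by Staller.
-- DomWinsD G D S : Dominator, to move, has a winning strategy.
-- DomWinsS G D S : Staller to move, Dominator has a winning strategy.
-- Dominator wins as soon as D is total dominating; if no free vertex is
-- left and D is not total dominating, Staller has won.
data DomWinsD {n} (G : Graph n) : Subset n → Subset n → Set
data DomWinsS {n} (G : Graph n) : Subset n → Subset n → Set

data DomWinsD {n} G where
  doneD : ∀ {D S} → TotalDominating G D → DomWinsD G D S
  moveD : ∀ {D S} v → Free D S v → DomWinsS G (⁅ v ⁆ ∪ D) S → DomWinsD G D S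

data DomWinsS {n} G where
  doneS : ∀ {D S} → TotalDominating G D → DomWinsS G D S
  moveS : ∀ {D S} → (∃ λ v → Free D S v)
        → (∀ v → Free D S v → DomWinsD G D (⁅ v ⁆ ∪ S))
        → DomWinsS G D S

IsD : ∀ {n} → Graph n → Set
IsD G = DomWinsD G ⊥ ⊥ × DomWinsS G ⊥ ⊥

DMinimal : ∀ {n} → Graph n → Set
DMinimal G = Connected G × IsD G × (∀ u v → G u v → ¬ IsD (removeEdge G u v))

-- Complete bipartite graph K_{2,k} on Fin (2 + k): part {0,1} and part {2,…}.
K2 : (k : ℕ) → Graph (suc (suc k))
K2 k x y = ¬ ((toℕ x < 2) ⇔ (toℕ y < 2))
  where
  _⇔_ : Set → Set → Set
  A ⇔ B = (A → B) × (B → A)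

P2 : Graph 2
P2 i j = i ≢ j

Cycle : (m : ℕ) → .{{NonZero m}} → Graph m
Cycle m i j = toℕ j ≡ suc (toℕ i) % m ⊎ toℕ i ≡ suc (toℕ j) % m

_□_ : ∀ {a b} → Graph a → Graph b → Graph (a * b)
_□_ {a} {b} G H x y =
  (G (fst x) (fst y) × snd x ≡ snd y) ⊎ (fst x ≡ fst y × H (snd x) (snd y))
  where
  fst : Fin (a * b) → Fin a
  fst z = proj₁ (remQuot {a} b z)
  snd : Fin (a * b) → Fin b
  snd z = proj₂ (remQuot {a} b z)

module Submission where

-- Dominator wins on K_{2,k} (k ≥ 2) and on the prism P₂ □ C_{2k+1} by a pairing strategy:
-- there are disjoint pairs of vertices such that every vertex has both members of some pair
-- as neighbours, and Dominator answers each Staller move inside a pair with its partner. In K_{2,k} the B-endpoint of the edge keeps a single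
-- neighbour, which Staller claims at once. In the prism Staller makes forcing moves, each
-- leaving a vertex with one free neighbour that Dominator must take, until a last move leaves
-- two such vertices. Next to a deleted rung two moves suffice; next to a deleted cycle edge
-- (r, a)(r, a + 1) Staller claims (r, a + 2), (r, a + 4), …, and as the cycle is odd the k-th
-- move is (r, a − 1), isolating (r, a) up to its rung.

open import Defs
open import Data.Nat using (ℕ; zero; suc; _+_; _*_; _∸_; _≤_; _<_; _%_; z≤n; s≤s; NonZero; _<?_)
open import Data.Nat.Properties
  using (≤-refl; ≤-trans; ≤-<-trans; ≤-total; <⇒≢; ≮⇒≥; +-comm; +-assoc; +-suc; +-identityʳ; +-cancelʳ-≡; m<n+m; m<n⇒m<1+n; ≤∧≢⇒<; <⇒≤; m∸n+n≡m; m<n+o⇒m∸n<o; +-mono-<; n≢0⇒n>0; m≤n⇒∃[o]m+o≡n; m≤n+m; ≤-antisym; +-monoˡ-≤; +-monoʳ-≤; *-monoʳ-≤; *-suc; *-cancelˡ-≡; suc-injective; <-trans; n<1+n; n≤1+n)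
open import Data.Nat.DivMod using (_mod_; m%n<n; %-distribˡ-+; m%n%n≡m%n; m<n⇒m%n≡m; [m+n]%n≡m%n; m≤n⇒[n∸m]%m≡n%m)
open import Data.Nat.Divisibility using (_∣_; divides; m%n≡0⇒n∣m; >⇒∤)
open import Data.Fin using (Fin; zero; suc; toℕ; _≟_; opposite; _↑ˡ_; combine; remQuot)
open import Data.Fin.Subset using (Subset; _∈_; _∉_; _∪_; ⁅_⁆; ⊥; ∣_∣)
open import Data.Fin.Properties
  using (any?; toℕ-fromℕ<; toℕ-injective; toℕ<n; remQuot-combine; combine-remQuot; combine-injectiveˡ; combine-injectiveʳ; opposite-involutive)
open import Data.Fin.Subset.Properties using (x∈p∪q⁺; x∈p∪q⁻; x∈⁅x⁆; x∈⁅y⁆⇒x≡y; _∈?_; ∉⊥; ∈⊤; ∣p∣≤n; ∣p∣≡n⇒p≡⊤; p⊂q⇒∣p∣<∣q∣)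
open import Function using (_∘_; id)
open import Function.Definitions using (Injective)
open import Data.Product as Product using (∃; _×_; _,_; proj₁; proj₂)
open import Data.Sum as Sum using (_⊎_; inj₁; inj₂)
open import Relation.Nullary using (¬_; Dec; yes; no; ¬?; contradiction)
open import Relation.Nullary.Decidable using (_×-dec_; _⊎-dec_)
open import Relation.Binary.Core using (_⇒_)
open import Relation.Binary.Definitions using (Symmetric)
open import Relation.Binary.PropositionalEquality
  using (_≡_; _≢_; refl; sym; trans; cong; subst; subst₂; cong₂; module ≡-Reasoning)

module _ (m : ℕ) .{{_ : NonZero m}} where

  open ≡-Reasoning

  [a+b%m]%m≡[a+b]%m : ∀ a b → (a + b % m) % m ≡ (a + b) % m
  [a+b%m]%m≡[a+b]%m a b = begin
    (a + b % m) % m         ≡⟨ %-distribˡ-+ a (b % m) m ⟩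
    (a % m + b % m % m) % m ≡⟨ cong (λ z → (a % m + z) % m) (m%n%n≡m%n b m) ⟩
    (a % m + b % m) % m     ≡⟨ %-distribˡ-+ a b m ⟨
    (a + b) % m             ∎

  [d+r]%m≢r : ∀ {d r} → 0 < d → d < m → r < m → (d + r) % m ≢ r
  [d+r]%m≢r {d} {r} 0<d d<m r<m eq with d + r <? m
  ... | yes d+r<m = <⇒≢ (m<n+m r 0<d) (sym (trans (sym (m<n⇒m%n≡m d+r<m)) eq))
  ... | no  d+r≮m = <⇒≢ d<m (+-cancelʳ-≡ r d m (begin
    d + r           ≡⟨ m∸n+n≡m m≤d+r ⟨
    d + r ∸ m + m   ≡⟨ cong (_+ m) wrapped ⟩
    r + m           ≡⟨ +-comm r m ⟩
    m + r           ∎))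
    where
    m≤d+r : m ≤ d + r
    m≤d+r = ≮⇒≥ d+r≮m
    wrapped : d + r ∸ m ≡ r
    wrapped = begin
      d + r ∸ m           ≡⟨ m<n⇒m%n≡m (m<n+o⇒m∸n<o (d + r) m (+-mono-< d<m r<m)) ⟨
      (d + r ∸ m) % m     ≡⟨ m≤n⇒[n∸m]%m≡n%m m≤d+r ⟩
      (d + r) % m         ≡⟨ eq ⟩
      r                   ∎

  [d+a]%m≡a%m⇒m∣d : ∀ d a → (d + a) % m ≡ a % m → m ∣ d
  [d+a]%m≡a%m⇒m∣d d a eq with d % m Data.Nat.≟ 0
  ... | yes d%m≡0 = m%n≡0⇒n∣m d m d%m≡0
  ... | no  d%m≢0 = contradiction residue ([d+r]%m≢r (n≢0⇒n>0 d%m≢0) (m%n<n d m) (m%n<n a m))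
    where
    residue : (d % m + a % m) % m ≡ a % m
    residue = trans (sym (%-distribˡ-+ d a m)) eq

  [c+a]%m≡[c′+a]%m⇒c≡c′ : ∀ {c c′} a → c < m → c′ < m →
                          (c + a) % m ≡ (c′ + a) % m → c ≡ c′
  [c+a]%m≡[c′+a]%m⇒c≡c′ {c} {c′} a c<m c′<m eq =
    Sum.[_,_]′ (λ c≤c′ → ordered c≤c′ c′<m eq) (λ c′≤c → sym (ordered c′≤c c<m (sym eq)))
               (≤-total c c′)
    where
    ordered : ∀ {c c′} → c ≤ c′ → c′ < m → (c + a) % m ≡ (c′ + a) % m → c ≡ c′
    ordered {c} c≤c′ c′<m eq with m≤n⇒∃[o]m+o≡n c≤c′
    ... | zero  , c+0≡c′ = trans (sym (+-identityʳ c)) c+0≡c′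
    ... | suc δ , refl   = contradiction ([d+a]%m≡a%m⇒m∣d (suc δ) (c + a) shifted)
                                         (>⇒∤ (≤-<-trans (m≤n+m (suc δ) c) c′<m))
      where
      shifted : (suc δ + (c + a)) % m ≡ (c + a) % m
      shifted = begin
        (suc δ + (c + a)) % m ≡⟨ cong (_% m) (+-assoc (suc δ) c a) ⟨
        (suc δ + c + a) % m   ≡⟨ cong (λ z → (z + a) % m) (+-comm (suc δ) c) ⟩
        (c + suc δ + a) % m   ≡⟨ eq ⟨
        (c + a) % m           ∎

module _ {n : ℕ} {G : Graph n} where

  Reach-trans : ∀ {x y z} → Reach G x y → Reach G y z → Reach G x z
  Reach-trans p here       = p
  Reach-trans p (step q e) = step (Reach-trans p q) e

  Reach-sym : Symmetric G → ∀ {x y} → Reach G x y → Reach G y x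
  Reach-sym sym-G here       = here
  Reach-sym sym-G (step p e) = Reach-trans (step here (sym-G e)) (Reach-sym sym-G p)

  hub⇒Connected : Symmetric G → ∀ h → (∀ u → Reach G h u) → Connected G
  hub⇒Connected sym-G h reach x y = Reach-trans (Reach-sym sym-G (reach x)) (reach y)

□-symmetric : ∀ {a b} {G : Graph a} {H : Graph b} → Symmetric G → Symmetric H → Symmetric (G □ H)
□-symmetric sym-G sym-H (inj₁ (e , same)) = inj₁ (sym-G e , sym same)
□-symmetric sym-G sym-H (inj₂ (same , e)) = inj₂ (sym same , sym-H e)

removeEdge-⇒ : ∀ {n} (G : Graph n) u v → removeEdge G u v ⇒ G
removeEdge-⇒ G u v = proj₁

removeEdge-removes : ∀ {n} (G : Graph n) u v → ¬ removeEdge G u v u v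
removeEdge-removes G u v (_ , kept) = kept (inj₁ (refl , refl))

removeEdge-removes⁻ : ∀ {n} (G : Graph n) u v → ¬ removeEdge G u v v u
removeEdge-removes⁻ G u v (_ , kept) = kept (inj₂ (refl , refl))

module _ {n : ℕ} where

  ∈-insert⁻ : ∀ {u z} {A : Subset n} → u ∈ ⁅ z ⁆ ∪ A → u ≡ z ⊎ u ∈ A
  ∈-insert⁻ {z = z} {A} u∈ = Sum.map₁ (x∈⁅y⁆⇒x≡y z) (x∈p∪q⁻ ⁅ z ⁆ A u∈)

  ∈-insert-self : ∀ z {A : Subset n} → z ∈ ⁅ z ⁆ ∪ A
  ∈-insert-self z = x∈p∪q⁺ (inj₁ (x∈⁅x⁆ z))

  ∈-insert-old : ∀ {u} z {A : Subset n} → u ∈ A → u ∈ ⁅ z ⁆ ∪ A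
  ∈-insert-old z u∈A = x∈p∪q⁺ (inj₂ u∈A)

  ∉-insert : ∀ {u z} {A : Subset n} → u ≢ z → u ∉ A → u ∉ ⁅ z ⁆ ∪ A
  ∉-insert u≢z u∉A u∈ = Sum.[ u≢z , u∉A ] (∈-insert⁻ u∈)

  prefix : (ℕ → Fin n) → ℕ → Subset n
  prefix f zero    = ⊥
  prefix f (suc t) = ⁅ f t ⁆ ∪ prefix f t

  ∈-prefix⁻ : ∀ f t {u} → u ∈ prefix f t → ∃ λ i → i < t × u ≡ f i
  ∈-prefix⁻ f zero    u∈ = contradiction u∈ ∉⊥
  ∈-prefix⁻ f (suc t) u∈ with ∈-insert⁻ u∈
  ... | inj₁ u≡ = t , ≤-refl , u≡
  ... | inj₂ u∈′ = let i , i<t , u≡ = ∈-prefix⁻ f t u∈′ in i , m<n⇒m<1+n i<t , u≡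

  ∈-prefix⁺ : ∀ f {t i} → i < t → f i ∈ prefix f t
  ∈-prefix⁺ f {suc t} {i} (s≤s i≤t) with i Data.Nat.≟ t
  ... | yes refl = ∈-insert-self (f i)
  ... | no  i≢t  = ∈-insert-old (f t) (∈-prefix⁺ f (≤∧≢⇒< i≤t i≢t))

module Game {n : ℕ} (G : Graph n) where

  Disjoint : Subset n → Subset n → Set
  Disjoint D S = ∀ {u} → u ∈ D → u ∉ S

  Disjoint-insertᴰ : ∀ {D S z} → z ∉ S → Disjoint D S → Disjoint (⁅ z ⁆ ∪ D) S
  Disjoint-insertᴰ z∉S disj u∈ with ∈-insert⁻ u∈
  ... | inj₁ refl = z∉S
  ... | inj₂ u∈D  = disj u∈D

  Disjoint-insertˢ : ∀ {D S z} → z ∉ D → Disjoint D S → Disjoint D (⁅ z ⁆ ∪ S)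
  Disjoint-insertˢ z∉D disj u∈D u∈ with ∈-insert⁻ u∈
  ... | inj₁ refl = z∉D u∈D
  ... | inj₂ u∈S  = disj u∈D u∈S

  Isolated : Subset n → Fin n → Set
  Isolated S v = ∀ u → G u v → u ∈ S

  Threat : Subset n → Fin n → Fin n → Set
  Threat S v x = ∀ u → G u v → u ≡ x ⊎ u ∈ S

  ¬TD-isolated : ∀ {D S v} → Disjoint D S → Isolated S v → ¬ TotalDominating G D
  ¬TD-isolated {v = v} disj iso td = let u , u∈D , e = td v in disj u∈D (iso u e)

  ¬TD-threat : ∀ {D S v x} → Disjoint D S → x ∉ D → Threat S v x → ¬ TotalDominating G D
  ¬TD-threat {v = v} disj x∉D threat td with td v
  ... | u , u∈D , e with threat u e
  ...   | inj₁ refl = x∉D u∈D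
  ...   | inj₂ u∈S  = disj u∈D u∈S

  ¬DomWinsD-isolated : ∀ {D S v} → Disjoint D S → Isolated S v → ¬ DomWinsD G D S
  ¬DomWinsS-isolated : ∀ {D S v} → Disjoint D S → Isolated S v → ¬ DomWinsS G D S
  ¬DomWinsD-isolated disj iso (doneD td) = ¬TD-isolated disj iso td
  ¬DomWinsD-isolated disj iso (moveD z (_ , z∉S) w) = ¬DomWinsS-isolated (Disjoint-insertᴰ z∉S disj) iso w
  ¬DomWinsS-isolated disj iso (doneS td) = ¬TD-isolated disj iso td
  ¬DomWinsS-isolated disj iso (moveS (z , z∉D , z∉S) w) =
    ¬DomWinsD-isolated (Disjoint-insertˢ z∉D disj) (λ u e → ∈-insert-old z (iso u e))
      (w z (z∉D , z∉S))

  staller-plays : ∀ {D S} s → Free D S s → ¬ TotalDominating G D →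
                  ¬ DomWinsD G D (⁅ s ⁆ ∪ S) → ¬ DomWinsS G D S
  staller-plays s free ¬td ¬win (doneS td)  = ¬td td
  staller-plays s free ¬td ¬win (moveS _ w) = ¬win (w s free)

  ¬DomWinsS-threat : ∀ {D S v x} → Disjoint D S → x ∉ D → Threat S v x → ¬ DomWinsS G D S
  ¬DomWinsS-threat {D} {S} {v} {x} disj x∉D threat with x ∈? S
  ... | yes x∈S = ¬DomWinsS-isolated disj isolated
    where
    isolated : Isolated S v
    isolated u e = Sum.[ (λ { refl → x∈S }) , id ] (threat u e)
  ... | no  x∉S = staller-plays x (x∉D , x∉S) (¬TD-threat disj x∉D threat)
                    (¬DomWinsD-isolated (Disjoint-insertˢ x∉D disj) isolated)
    where
    isolated : Isolated (⁅ x ⁆ ∪ S) v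
    isolated u e = Sum.[ (λ { refl → ∈-insert-self x }) , ∈-insert-old x ] (threat u e)

  ¬DomWinsD-forced : ∀ {D S v x} → Disjoint D S → x ∉ D → Threat S v x →
                     (x ∉ S → ¬ DomWinsS G (⁅ x ⁆ ∪ D) S) → ¬ DomWinsD G D S
  ¬DomWinsD-forced disj x∉D threat ¬win (doneD td) = ¬TD-threat disj x∉D threat td
  ¬DomWinsD-forced {x = x} disj x∉D threat ¬win (moveD z (_ , z∉S) w) with z ≟ x
  ... | yes refl = ¬win z∉S w
  ... | no  z≢x  = ¬DomWinsS-threat (Disjoint-insertᴰ z∉S disj) (∉-insert (z≢x ∘ sym) x∉D) threat w

  ¬DomWinsD-fork : ∀ {D S v x w y} → Disjoint D S → x ∉ D → y ∉ D → x ≢ y →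
                   Threat S v x → Threat S w y → ¬ DomWinsD G D S
  ¬DomWinsD-fork disj x∉D y∉D x≢y threatˣ threatʸ =
    ¬DomWinsD-forced disj x∉D threatˣ
      (λ x∉S → ¬DomWinsS-threat (Disjoint-insertᴰ x∉S disj) (∉-insert (x≢y ∘ sym) y∉D) threatʸ)

  -- s is Staller's next move. After force Dominator must answer x; a fork leaves two such
  -- threats, and he cannot answer both.
  data StallerStrategy (D S : Subset n) : Set where
    isolate : ∀ s v → Free D S s → Isolated (⁅ s ⁆ ∪ S) v → StallerStrategy D S
    fork    : ∀ s v x w y → Free D S s → x ∉ D → y ∉ D → x ≢ y →
              Threat (⁅ s ⁆ ∪ S) v x → Threat (⁅ s ⁆ ∪ S) w y → StallerStrategy D S
    force   : ∀ s v x → Free D S s → x ∉ D → Threat (⁅ s ⁆ ∪ S) v x →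
              StallerStrategy (⁅ x ⁆ ∪ D) (⁅ s ⁆ ∪ S) → StallerStrategy D S

  StallerStrategy⇒¬DomWinsS : ∀ {D S} → Disjoint D S → StallerStrategy D S → ¬ DomWinsS G D S
  StallerStrategy⇒¬DomWinsS disj (isolate s v free@(s∉D , _) iso) =
    staller-plays s free (¬TD-isolated disj′ iso) (¬DomWinsD-isolated disj′ iso)
    where disj′ = Disjoint-insertˢ s∉D disj
  StallerStrategy⇒¬DomWinsS disj (fork s v x w y free@(s∉D , _) x∉D y∉D x≢y threatˣ threatʸ) =
    staller-plays s free (¬TD-threat disj′ x∉D threatˣ)
      (¬DomWinsD-fork disj′ x∉D y∉D x≢y threatˣ threatʸ)
    where disj′ = Disjoint-insertˢ s∉D disj
  StallerStrategy⇒¬DomWinsS disj (force s v x free@(s∉D , _) x∉D threat next) =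
    staller-plays s free (¬TD-threat disj′ x∉D threat)
      (¬DomWinsD-forced disj′ x∉D threat
        (λ x∉S → StallerStrategy⇒¬DomWinsS (Disjoint-insertᴰ x∉S disj′) next))
    where disj′ = Disjoint-insertˢ s∉D disj

  StallerStrategy⇒¬IsD : StallerStrategy ⊥ ⊥ → ¬ IsD G
  StallerStrategy⇒¬IsD strategy (_ , win) = StallerStrategy⇒¬DomWinsS (λ _ → ∉⊥) strategy win

  -- Staller plays s 0, …, s K; each s t forces Dominator to take x t, and s K also threatens w.
  record ForcingChain (K : ℕ) : Set where
    field
      s x v      : ℕ → Fin n
      w y        : Fin n
      x≢s        : ∀ i j → x i ≢ s j
      s-distinct : ∀ {i j} → i < j → j ≤ K → s i ≢ s j
      x-distinct : ∀ {i j} → i < j → j ≤ K → x i ≢ x j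
      y≢x        : ∀ {i} → i ≤ K → y ≢ x i
      threatᵛ    : ∀ {t} → t ≤ K → ∀ u → G u (v t) → u ≡ x t ⊎ ∃ λ i → i ≤ t × u ≡ s i
      threatʷ    : ∀ u → G u w → u ≡ y ⊎ ∃ λ i → i ≤ K × u ≡ s i

  ForcingChain⇒StallerStrategy : ∀ {K} → ForcingChain K → StallerStrategy ⊥ ⊥
  ForcingChain⇒StallerStrategy {K} chain = position K 0 (+-identityʳ K)
    where
    open ForcingChain chain

    Dₜ Sₜ : ℕ → Subset n
    Dₜ = prefix x
    Sₜ = prefix s

    s-free : ∀ {t} → t ≤ K → Free (Dₜ t) (Sₜ t) (s t)
    s-free {t} t≤K = (λ s∈ → let i , _ , e = ∈-prefix⁻ x t s∈ in x≢s i t (sym e))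
                   , (λ s∈ → let i , i<t , e = ∈-prefix⁻ s t s∈ in s-distinct i<t t≤K (sym e))

    x-new : ∀ {t} → t ≤ K → x t ∉ Dₜ t
    x-new {t} t≤K x∈ = let i , i<t , e = ∈-prefix⁻ x t x∈ in x-distinct i<t t≤K (sym e)

    played : ∀ {t i} → i ≤ t → s i ∈ ⁅ s t ⁆ ∪ Sₜ t
    played i≤t = ∈-prefix⁺ s (s≤s i≤t)

    threat-at : ∀ {t} → t ≤ K → Threat (⁅ s t ⁆ ∪ Sₜ t) (v t) (x t)
    threat-at t≤K u e = Sum.map₂ (λ { (i , i≤t , refl) → played i≤t }) (threatᵛ t≤K u e)

    position : ∀ d t → d + t ≡ K → StallerStrategy (Dₜ t) (Sₜ t)
    position zero t refl =
      fork (s t) (v t) (x t) w y (s-free ≤-refl) (x-new ≤-refl) y-new (y≢x ≤-refl ∘ sym)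
        (threat-at ≤-refl)
        (λ u e → Sum.map₂ (λ { (i , i≤t , refl) → played i≤t }) (threatʷ u e))
      where
      y-new : y ∉ Dₜ t
      y-new y∈ = let i , i<t , e = ∈-prefix⁻ x t y∈ in y≢x (<⇒≤ i<t) e
    position (suc d) t eq =
      force (s t) (v t) (x t) (s-free t≤K) (x-new t≤K) (threat-at t≤K)
        (position d (suc t) (trans (+-suc d t) eq))
      where
      t≤K : t ≤ K
      t≤K = subst (t ≤_) eq (m≤n+m t (suc d))

  record PairingTotalDominatingSet : Set where
    field
      pairs       : ℕ
      a b         : Fin pairs → Fin n
      a≢b         : ∀ p q → a p ≢ b q
      a-injective : Injective _≡_ _≡_ a
      b-injective : Injective _≡_ _≡_ b
      covers      : ∀ v → ∃ λ p → G (a p) v × G (b p) v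

  module PairingStrategy (pairing : PairingTotalDominatingSet) where

    open PairingTotalDominatingSet pairing

    OnPair : Fin n → Fin pairs → Set
    OnPair v p = a p ≡ v ⊎ b p ≡ v

    Hit : Subset n → Fin pairs → Set
    Hit D p = a p ∈ D ⊎ b p ∈ D

    Open : Subset n → Subset n → Fin pairs → Set
    Open D S p = Free D S (a p) × Free D S (b p)

    Invariant : Subset n → Subset n → Set
    Invariant D S = ∀ p → Hit D p ⊎ Open D S p

    free? : ∀ (D S : Subset n) z → Dec (Free D S z)
    free? D S z = ¬? (z ∈? D) ×-dec ¬? (z ∈? S)

    open? : ∀ D S p → Dec (Open D S p)
    open? D S p = free? D S (a p) ×-dec free? D S (b p)

    onPair? : ∀ v p → Dec (OnPair v p)
    onPair? v p = (a p ≟ v) ⊎-dec (b p ≟ v)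

    pair-unique : ∀ {v p q} → OnPair v p → OnPair v q → p ≡ q
    pair-unique {p = p} {q} (inj₁ refl) (inj₁ e) = a-injective (sym e)
    pair-unique {p = p} {q} (inj₁ refl) (inj₂ e) = contradiction (sym e) (a≢b p q)
    pair-unique {p = p} {q} (inj₂ refl) (inj₁ e) = contradiction e (a≢b q p)
    pair-unique {p = p} {q} (inj₂ refl) (inj₂ e) = b-injective (sym e)

    partner : ∀ {v} p → OnPair v p → Fin n
    partner p (inj₁ _) = b p
    partner p (inj₂ _) = a p

    partner-hits : ∀ {v D} p (on : OnPair v p) → Hit (⁅ partner p on ⁆ ∪ D) p
    partner-hits p (inj₁ _) = inj₂ (∈-insert-self (b p))
    partner-hits p (inj₂ _) = inj₁ (∈-insert-self (a p))

    partner-free : ∀ {v D S} p → Open D S p → (on : OnPair v p) → Free D (⁅ v ⁆ ∪ S) (partner p on)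
    partner-free p (_ , b∉D , b∉S) (inj₁ refl) = b∉D , ∉-insert (a≢b p p ∘ sym) b∉S
    partner-free p ((a∉D , a∉S) , _) (inj₂ refl) = a∉D , ∉-insert (a≢b p p) a∉S

    initial : Invariant ⊥ ⊥
    initial p = inj₂ ((∉⊥ , ∉⊥) , (∉⊥ , ∉⊥))

    Invariant-dominator : ∀ {D S} z → Invariant D S → Invariant (⁅ z ⁆ ∪ D) S
    Invariant-dominator z inv p with inv p | a p ≟ z | b p ≟ z
    ... | inj₁ hit | _ | _ = inj₁ (Sum.map (∈-insert-old z) (∈-insert-old z) hit)
    ... | inj₂ _ | yes refl | _ = inj₁ (inj₁ (∈-insert-self z))
    ... | inj₂ _ | no _ | yes refl = inj₁ (inj₂ (∈-insert-self z))
    ... | inj₂ ((a∉D , a∉S) , (b∉D , b∉S)) | no a≢z | no b≢z =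
      inj₂ ((∉-insert a≢z a∉D , a∉S) , (∉-insert b≢z b∉D , b∉S))

    Invariant-staller : ∀ {D S} v → Invariant D S → (∀ p → OnPair v p → Hit D p) →
                        Invariant D (⁅ v ⁆ ∪ S)
    Invariant-staller v inv hit-through-v p with inv p | onPair? v p
    ... | inj₁ hit | _ = inj₁ hit
    ... | inj₂ _ | yes on = inj₁ (hit-through-v p on)
    ... | inj₂ ((a∉D , a∉S) , (b∉D , b∉S)) | no ¬on =
      inj₂ ((a∉D , ∉-insert (¬on ∘ inj₁) a∉S) , (b∉D , ∉-insert (¬on ∘ inj₂) b∉S))

    dominated : ∀ {D S} → Invariant D S → ¬ ∃ (Open D S) → TotalDominating G D
    dominated inv none v with covers v
    ... | p , eᵃ , eᵇ with inv p
    ...   | inj₁ (inj₁ a∈D) = a p , a∈D , eᵃ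
    ...   | inj₁ (inj₂ b∈D) = b p , b∈D , eᵇ
    ...   | inj₂ isOpen     = contradiction (p , isOpen) none

    full : ∀ {S} → n ≤ ∣ S ∣ → ∀ u → u ∈ S
    full {S} n≤∣S∣ u = subst (u ∈_) (sym (∣p∣≡n⇒p≡⊤ (≤-antisym (∣p∣≤n S) n≤∣S∣))) ∈⊤

    spend : ∀ {S : Subset n} {v f} → v ∉ S → n ≤ ∣ S ∣ + suc f → n ≤ ∣ ⁅ v ⁆ ∪ S ∣ + f
    spend {S} {v} {f} v∉S room = ≤-trans room (subst (_≤ ∣ ⁅ v ⁆ ∪ S ∣ + f) (sym (+-suc ∣ S ∣ f))
      (+-monoˡ-≤ f (p⊂q⇒∣p∣<∣q∣ (∈-insert-old v , v , ∈-insert-self v , v∉S))))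

    -- f bounds Staller's remaining moves: each one enlarges S, which has at most n elements.
    dominator-turn : ∀ f {D S} → n ≤ ∣ S ∣ + f → Invariant D S → DomWinsD G D S
    staller-turn   : ∀ f {D S} → n ≤ ∣ S ∣ + f → Invariant D S → DomWinsS G D S

    dominator-turn f {D} {S} room inv with any? (open? D S)
    ... | no  none             = doneD (dominated inv none)
    ... | yes (p , a-free , _) = moveD (a p) a-free (staller-turn f room (Invariant-dominator (a p) inv))

    staller-turn zero {D} {S} room inv with any? (open? D S)
    ... | no  none                 = doneS (dominated inv none)
    ... | yes (p , (_ , a∉S) , _) = contradiction (full (subst (n ≤_) (+-identityʳ _) room) (a p)) a∉S
    staller-turn (suc f) {D} {S} room inv with any? (open? D S)
    ... | no  none             = doneS (dominated inv none)
    ... | yes (p , a-free , _) = moveS (a p , a-free) reply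
      where
      reply : ∀ v → Free D S v → DomWinsD G D (⁅ v ⁆ ∪ S)
      reply v (_ , v∉S) with any? (λ q → open? D S q ×-dec onPair? v q)
      ... | yes (q , isOpen , on) =
        moveD (partner q on) (partner-free q isOpen on)
          (staller-turn f (spend v∉S room) (Invariant-staller v (Invariant-dominator (partner q on) inv)
            (λ p on′ → subst (Hit _) (pair-unique on on′) (partner-hits q on))))
      ... | no none = dominator-turn f (spend v∉S room)
          (Invariant-staller v inv
            (λ p on → Sum.[ id , (λ isOpen → contradiction (p , isOpen , on) none) ] (inv p)))

    dominator-wins : IsD G
    dominator-wins = dominator-turn n (m≤n+m n _) initial , staller-turn n (m≤n+m n _) initial

  Pairing⇒IsD : PairingTotalDominatingSet → IsD G
  Pairing⇒IsD = PairingStrategy.dominator-wins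

  unique-neighbour⇒¬IsD : ∀ s v → (∀ u → G u v → u ≡ s) → ¬ IsD G
  unique-neighbour⇒¬IsD s v only =
    StallerStrategy⇒¬IsD
      (isolate s v (∉⊥ , ∉⊥) (λ u e → subst (_∈ ⁅ s ⁆ ∪ ⊥) (sym (only u e)) (∈-insert-self s)))

open Game

≢⇒≡opposite : ∀ {r r′ : Fin 2} → r′ ≢ r → r′ ≡ opposite r
≢⇒≡opposite {zero}     {zero}     r′≢r = contradiction refl r′≢r
≢⇒≡opposite {zero}     {suc zero} _    = refl
≢⇒≡opposite {suc zero} {zero}     _    = refl
≢⇒≡opposite {suc zero} {suc zero} r′≢r = contradiction refl r′≢r

opposite-≢ : ∀ (r : Fin 2) → opposite r ≢ r
opposite-≢ zero       ()
opposite-≢ (suc zero) ()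

module CompleteBipartite (k : ℕ) where

  A : Fin 2 → Fin (2 + k)
  A r = r ↑ˡ k

  InA : Fin (2 + k) → Set
  InA u = toℕ u < 2

  ∉A : ∀ (j : Fin k) → ¬ InA (suc (suc j))
  ∉A j (s≤s (s≤s ()))

  A-cases : ∀ {u} → InA u → ∃ λ r → u ≡ A r
  A-cases {zero}             _ = zero , refl
  A-cases {suc zero}         _ = suc zero , refl
  A-cases {suc (suc _)} (s≤s (s≤s ()))

  K2-symmetric : Symmetric (K2 k)
  K2-symmetric ¬iff iff = ¬iff (Product.swap iff)

  A-B-adjacent : ∀ {x y} → InA x → ¬ InA y → K2 k x y
  A-B-adjacent x∈A y∉A (to , _) = y∉A (to x∈A)

  ¬A-A-adjacent : ∀ {x y} → InA x → InA y → ¬ K2 k x y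
  ¬A-A-adjacent x∈A y∈A e = e ((λ _ → y∈A) , (λ _ → x∈A))

  ¬B-B-adjacent : ∀ {x y} → ¬ InA x → ¬ InA y → ¬ K2 k x y
  ¬B-B-adjacent x∉A y∉A e = e ((λ x∈A → contradiction x∈A x∉A) , (λ y∈A → contradiction y∈A y∉A))

  B-neighbour : ∀ {u v} → K2 k u v → ¬ InA v → InA u
  B-neighbour {u} e v∉A with toℕ u <? 2
  ... | yes u∈A = u∈A
  ... | no  u∉A = contradiction e (¬B-B-adjacent u∉A v∉A)

  missing-edge⇒¬IsD : ∀ {H} → H ⇒ K2 k → ∀ {a b} → InA a → ¬ InA b → ¬ H a b → ¬ IsD H
  missing-edge⇒¬IsD {H} H⇒K2 {b = b} a∈A b∉A ¬Hab with A-cases a∈A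
  ... | r , refl = unique-neighbour⇒¬IsD H (A (opposite r)) b only
    where
    only : ∀ u → H u b → u ≡ A (opposite r)
    only u e with A-cases (B-neighbour (H⇒K2 e) b∉A)
    ... | r′ , refl = cong A (≢⇒≡opposite {r} λ { refl → ¬Hab e })

  K2-minimal : ∀ u v → K2 k u v → ¬ IsD (removeEdge (K2 k) u v)
  K2-minimal u v e with toℕ u <? 2 | toℕ v <? 2
  ... | yes u∈A | yes v∈A = contradiction e (¬A-A-adjacent u∈A v∈A)
  ... | no  u∉A | no  v∉A = contradiction e (¬B-B-adjacent u∉A v∉A)
  ... | yes u∈A | no  v∉A = missing-edge⇒¬IsD (removeEdge-⇒ (K2 k) u v) u∈A v∉A (removeEdge-removes (K2 k) u v)
  ... | no  u∉A | yes v∈A = missing-edge⇒¬IsD (removeEdge-⇒ (K2 k) u v) v∈A u∉A (removeEdge-removes⁻ (K2 k) u v)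

K2-connected : ∀ k → 1 ≤ k → Connected (K2 k)
K2-connected (suc j) (s≤s z≤n) = hub⇒Connected K2-symmetric zero reach
  where
  open CompleteBipartite (suc j)

  reach : ∀ u → Reach (K2 (suc j)) zero u
  reach u with toℕ u <? 2
  ... | yes u∈A = step (step here (A-B-adjacent (s≤s z≤n) (∉A zero)))
                       (K2-symmetric (A-B-adjacent u∈A (∉A zero)))
  ... | no  u∉A = step here (A-B-adjacent (s≤s z≤n) u∉A)

K2-pairing : ∀ k → 2 ≤ k → PairingTotalDominatingSet (K2 k)
K2-pairing (suc (suc j)) (s≤s (s≤s z≤n)) = record
  { pairs = 2 ; a = a ; b = b ; a≢b = a≢b
  ; a-injective = a-injective ; b-injective = b-injective ; covers = covers }
  where
  open CompleteBipartite (suc (suc j))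

  a b : Fin 2 → Fin (4 + j)
  a zero       = zero
  a (suc zero) = suc (suc zero)
  b zero       = suc zero
  b (suc zero) = suc (suc (suc zero))

  a≢b : ∀ p q → a p ≢ b q
  a≢b zero       zero       ()
  a≢b zero       (suc zero) ()
  a≢b (suc zero) zero       ()
  a≢b (suc zero) (suc zero) ()

  a-injective : ∀ {p q} → a p ≡ a q → p ≡ q
  a-injective {zero}     {zero}     _ = refl
  a-injective {suc zero} {suc zero} _ = refl
  a-injective {zero}     {suc zero} ()
  a-injective {suc zero} {zero}     ()

  b-injective : ∀ {p q} → b p ≡ b q → p ≡ q
  b-injective {zero}     {zero}     _ = refl
  b-injective {suc zero} {suc zero} _ = refl
  b-injective {zero}     {suc zero} ()
  b-injective {suc zero} {zero}     ()

  covers : ∀ v → ∃ λ p → K2 (suc (suc j)) (a p) v × K2 (suc (suc j)) (b p) v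
  covers v with toℕ v <? 2
  ... | yes v∈A = suc zero , K2-symmetric (A-B-adjacent v∈A (∉A zero))
                           , K2-symmetric (A-B-adjacent v∈A (∉A (suc zero)))
  ... | no  v∉A = zero , A-B-adjacent (s≤s z≤n) v∉A , A-B-adjacent (s≤s (s≤s z≤n)) v∉A

module Prism (k : ℕ) where

  M m : ℕ
  M = 2 * k
  m = suc M

  G : Graph (2 * m)
  G = P2 □ Cycle m

  row : Fin (2 * m) → Fin 2
  row u = proj₁ (remQuot {2} m u)

  col : Fin (2 * m) → Fin m
  col u = proj₂ (remQuot {2} m u)

  -- Columns are taken mod m, so column M + a is the predecessor of column a.
  cell : Fin 2 → ℕ → Fin (2 * m)
  cell r a = combine r (a mod m)

  toℕ-mod : ∀ a → toℕ (a mod m) ≡ a % m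
  toℕ-mod a = toℕ-fromℕ< (m%n<n a m)

  mod-cong : ∀ a b → a % m ≡ b % m → a mod m ≡ b mod m
  mod-cong a b eq = toℕ-injective (trans (toℕ-mod a) (trans eq (sym (toℕ-mod b))))

  toℕ-mod-inverse : ∀ (c : Fin m) → toℕ c mod m ≡ c
  toℕ-mod-inverse c = toℕ-injective (trans (toℕ-mod (toℕ c)) (m<n⇒m%n≡m (toℕ<n c)))

  suc-mod : ∀ a → suc (toℕ (a mod m)) mod m ≡ suc a mod m
  suc-mod a = mod-cong (suc (toℕ (a mod m))) (suc a)
    (trans (cong (λ z → suc z % m) (toℕ-mod a)) ([a+b%m]%m≡[a+b]%m m 1 a))

  ≡suc-mod : ∀ {c : Fin m} a → toℕ c ≡ suc a % m → c ≡ suc a mod m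
  ≡suc-mod a eq = toℕ-injective (trans eq (sym (toℕ-mod (suc a))))

  [m+a]%m≡a%m : ∀ a → (m + a) % m ≡ a % m
  [m+a]%m≡a%m a = trans (cong (_% m) (+-comm m a)) ([m+n]%n≡m%n a m)

  ≡pred-mod : ∀ {c : Fin m} a → toℕ (a mod m) ≡ suc (toℕ c) % m → c ≡ (M + a) mod m
  ≡pred-mod {c} a eq = toℕ-injective (begin
    toℕ c                            ≡⟨ m<n⇒m%n≡m (toℕ<n c) ⟨
    toℕ c % m                        ≡⟨ [m+a]%m≡a%m (toℕ c) ⟨
    (m + toℕ c) % m                  ≡⟨ cong (_% m) (+-suc M (toℕ c)) ⟨
    (M + suc (toℕ c)) % m            ≡⟨ [a+b%m]%m≡[a+b]%m m M (suc (toℕ c)) ⟨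
    (M + suc (toℕ c) % m) % m        ≡⟨ cong (λ z → (M + z) % m) eq ⟨
    (M + toℕ (a mod m)) % m          ≡⟨ cong (λ z → (M + z) % m) (toℕ-mod a) ⟩
    (M + a % m) % m                  ≡⟨ [a+b%m]%m≡[a+b]%m m M a ⟩
    (M + a) % m                      ≡⟨ toℕ-mod (M + a) ⟨
    toℕ ((M + a) mod m)              ∎)
    where open ≡-Reasoning

  cell-cong : ∀ r a b → a % m ≡ b % m → cell r a ≡ cell r b
  cell-cong r a b eq = cong (combine r) (mod-cong a b eq)

  cell-periodic : ∀ r a → cell r (m + a) ≡ cell r a
  cell-periodic r a = cell-cong r (m + a) a ([m+a]%m≡a%m a)

  row-cell : ∀ r a → row (cell r a) ≡ r
  row-cell r a = cong proj₁ (remQuot-combine r (a mod m))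

  col-cell : ∀ r a → col (cell r a) ≡ a mod m
  col-cell r a = cong proj₂ (remQuot-combine r (a mod m))

  ≡cell : ∀ {u} r a → row u ≡ r → col u ≡ a mod m → u ≡ cell r a
  ≡cell {u} r a r≡ c≡ = trans (sym (combine-remQuot {2} m u)) (cong₂ combine r≡ c≡)

  cell-η : ∀ u → u ≡ cell (row u) (toℕ (col u))
  cell-η u = ≡cell (row u) (toℕ (col u)) refl (sym (toℕ-mod-inverse (col u)))

  cell-row-injective : ∀ {r r′} a b → cell r a ≡ cell r′ b → r ≡ r′
  cell-row-injective {r} {r′} a b = combine-injectiveˡ r (a mod m) r′ (b mod m)

  cell-%-injective : ∀ r r′ a b → cell r a ≡ cell r′ b → a % m ≡ b % m
  cell-%-injective r r′ a b eq = begin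
    a % m              ≡⟨ toℕ-mod a ⟨
    toℕ (a mod m)      ≡⟨ cong toℕ (combine-injectiveʳ r (a mod m) r′ (b mod m) eq) ⟩
    toℕ (b mod m)      ≡⟨ toℕ-mod b ⟩
    b % m              ∎
    where open ≡-Reasoning

  cell-window : ∀ r r′ c c′ a → c < m → c′ < m → cell r (c + a) ≡ cell r′ (c′ + a) → c ≡ c′
  cell-window r r′ c c′ a c<m c′<m eq =
    [c+a]%m≡[c′+a]%m⇒c≡c′ m a c<m c′<m (cell-%-injective r r′ (c + a) (c′ + a) eq)

  cell-rows-≢ : ∀ {r r′} a b → r ≢ r′ → cell r a ≢ cell r′ b
  cell-rows-≢ a b r≢r′ = r≢r′ ∘ cell-row-injective a b

  rung : ∀ r r′ a → r ≢ r′ → G (cell r a) (cell r′ a)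
  rung r r′ a r≢r′ = inj₁ ( subst₂ _≢_ (sym (row-cell r a)) (sym (row-cell r′ a)) r≢r′
                              , trans (col-cell r a) (sym (col-cell r′ a)) )

  along : ∀ r a → G (cell r a) (cell r (suc a))
  along r a = inj₂ ( trans (row-cell r a) (sym (row-cell r (suc a)))
                   , subst₂ (Cycle m) (sym (col-cell r a)) (sym (col-cell r (suc a))) (inj₁ toℕ-suc))
    where
    toℕ-suc : toℕ (suc a mod m) ≡ suc (toℕ (a mod m)) % m
    toℕ-suc = trans (cong toℕ (sym (suc-mod a))) (toℕ-mod (suc (toℕ (a mod m))))

  G-symmetric : Symmetric G
  G-symmetric {x} {y} = □-symmetric {G = P2} {H = Cycle m} (λ r≢r′ → r≢r′ ∘ sym) Sum.swap {x} {y}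

  along⁻ : ∀ r a → G (cell r (suc a)) (cell r a)
  along⁻ r a = G-symmetric {cell r a} {cell r (suc a)} (along r a)

  neighbours : ∀ {u} r a → G u (cell r a) →
               u ≡ cell (opposite r) a ⊎ u ≡ cell r (suc a) ⊎ u ≡ cell r (M + a)
  neighbours {u} r a (inj₁ (rows≢ , cols≡)) =
    inj₁ (≡cell (opposite r) a (≢⇒≡opposite (subst (row u ≢_) (row-cell r a) rows≢))
                                (trans cols≡ (col-cell r a)))
  neighbours {u} r a (inj₂ (rows≡ , adjacent)) =
    inj₂ (Sum.swap (Sum.map (λ pred → ≡cell r (M + a) row≡ (≡pred-mod a pred))
                            (λ succ → ≡cell r (suc a) row≡ (trans (≡suc-mod _ succ) (suc-mod a)))
                            (subst (Cycle m (col u)) (col-cell r a) adjacent)))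
    where
    row≡ : row u ≡ r
    row≡ = trans rows≡ (row-cell r a)

  neighbours-suc : ∀ {u} r a → G u (cell r (suc a)) →
                   u ≡ cell (opposite r) (suc a) ⊎ u ≡ cell r (suc (suc a)) ⊎ u ≡ cell r a
  neighbours-suc r a e = Sum.map₂ (Sum.map₂ (λ u≡ → trans u≡ predecessor)) (neighbours r (suc a) e)
    where
    predecessor : cell r (M + suc a) ≡ cell r a
    predecessor = trans (cong (cell r) (+-suc M a)) (cell-periodic r a)

  connected : Connected G
  connected = hub⇒Connected (λ {x y} → G-symmetric {x} {y}) (cell zero 0) reach
    where
    along-row : ∀ a → Reach G (cell zero 0) (cell zero a)
    along-row zero    = here
    along-row (suc a) = step (along-row a) (along zero a)

    reach-cell : ∀ r a → Reach G (cell zero 0) (cell r a)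
    reach-cell zero       a = along-row a
    reach-cell (suc zero) a = step (along-row a) (rung zero (suc zero) a λ ())

    reach : ∀ u → Reach G (cell zero 0) u
    reach u = subst (Reach G (cell zero 0)) (sym (cell-η u)) (reach-cell (row u) (toℕ (col u)))

  pairing : PairingTotalDominatingSet G
  pairing = record
    { pairs = m ; a = a ; b = b ; a≢b = a≢b
    ; a-injective = a-injective ; b-injective = b-injective ; covers = covers }
    where
    a b : Fin m → Fin (2 * m)
    a p = cell zero (suc (toℕ p))
    b p = combine {2} (suc zero) p

    a≢b : ∀ p q → a p ≢ b q
    a≢b p q eq with () ← combine-injectiveˡ {m = 2} zero (suc (toℕ p) mod m) (suc zero) q eq

    a-injective : ∀ {p q} → a p ≡ a q → p ≡ q
    a-injective {p} {q} eq = toℕ-injective (cell-window zero zero (toℕ p) (toℕ q) 1 (toℕ<n p) (toℕ<n q)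
      (subst₂ (λ i j → cell zero i ≡ cell zero j) (+-comm 1 (toℕ p)) (+-comm 1 (toℕ q)) eq))

    b-injective : ∀ {p q} → b p ≡ b q → p ≡ q
    b-injective {p} {q} = combine-injectiveʳ {m = 2} (suc zero) p (suc zero) q

    a-mod : ∀ t → a (t mod m) ≡ cell zero (suc t)
    a-mod t = cong (combine {2} zero) (suc-mod t)

    covers-cell : ∀ r t → ∃ λ p → G (a p) (cell r t) × G (b p) (cell r t)
    covers-cell zero t =
      t mod m , subst (λ z → G z (cell zero t)) (sym (a-mod t)) (along⁻ zero t) , rung (suc zero) zero t λ ()
    covers-cell (suc zero) t =
      (M + t) mod m
      , subst (λ z → G z (cell (suc zero) t)) (sym (trans (a-mod (M + t)) (cell-periodic zero t)))
              (rung zero (suc zero) t λ ())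
      , subst (G (b ((M + t) mod m))) (cell-periodic (suc zero) t) (along (suc zero) (M + t))

    covers : ∀ v → ∃ λ p → G (a p) v × G (b p) v
    covers v = subst (λ v → ∃ λ p → G (a p) v × G (b p) v) (sym (cell-η v))
                     (covers-cell (row v) (toℕ (col v)))

  data Edge : Fin (2 * m) → Fin (2 * m) → Set where
    rung-edge : ∀ r a → Edge (cell r a) (cell (opposite r) a)
    forward   : ∀ r a → Edge (cell r a) (cell r (suc a))
    backward  : ∀ r a → Edge (cell r (suc a)) (cell r a)

  edge-view : ∀ {u v} → G u v → Edge u v
  edge-view {u} {v} (inj₁ (rows≢ , cols≡)) =
    subst₂ Edge (sym (cell-η u)) (sym v≡) (rung-edge (row u) (toℕ (col u)))
    where
    v≡ : v ≡ cell (opposite (row u)) (toℕ (col u))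
    v≡ = ≡cell (opposite (row u)) (toℕ (col u)) (≢⇒≡opposite (rows≢ ∘ sym))
                                                 (trans (sym cols≡) (sym (toℕ-mod-inverse (col u))))
  edge-view {u} {v} (inj₂ (rows≡ , inj₁ succ)) =
    subst₂ Edge (sym (cell-η u)) (sym v≡) (forward (row u) (toℕ (col u)))
    where
    v≡ : v ≡ cell (row u) (suc (toℕ (col u)))
    v≡ = ≡cell (row u) (suc (toℕ (col u))) (sym rows≡) (≡suc-mod (toℕ (col u)) succ)
  edge-view {u} {v} (inj₂ (rows≡ , inj₂ pred)) =
    subst₂ Edge (sym u≡) (sym (cell-η v)) (backward (row v) (toℕ (col v)))
    where
    u≡ : u ≡ cell (row v) (suc (toℕ (col v)))
    u≡ = ≡cell (row v) (suc (toℕ (col v))) rows≡ (≡suc-mod (toℕ (col v)) pred)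

odd∤4 : ∀ K → ¬ suc (2 * suc K) ∣ 4
odd∤4 zero    (divides zero          ())
odd∤4 zero    (divides (suc zero)    ())
odd∤4 zero    (divides (suc (suc _)) ())
odd∤4 (suc K) = >⇒∤ (s≤s (*-monoʳ-≤ 2 {2} {2 + K} (s≤s (s≤s z≤n))))

module PrismMinimal (K : ℕ) where

  open Prism (suc K)

  missing-rung⇒¬IsD : ∀ {H} → H ⇒ G → ∀ r a →
                      ¬ H (cell r a) (cell (opposite r) a) → ¬ H (cell (opposite r) a) (cell r a) → ¬ IsD H
  missing-rung⇒¬IsD {H} H⇒G r a ¬H ¬H⁻ =
    StallerStrategy⇒¬IsD H
      (force s₀ v₀ x₀ (∉⊥ , ∉⊥) ∉⊥ threat₀
        (fork s₁ v₁ x₁ w y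
          ( ∉-insert (cell-rows-≢ (2 + a) (M + a) r′≢r) ∉⊥
          , ∉-insert (cell-rows-≢ (2 + a) (1 + a) r′≢r) ∉⊥ )
          (∉-insert x₁≢x₀ ∉⊥) (∉-insert (cell-rows-≢ a (M + a) r′≢r) ∉⊥)
          (cell-rows-≢ (3 + a) a (r′≢r ∘ sym)) threat₁ threatʷ))
    where
    r′ = opposite r
    r′≢r = opposite-≢ r
    s₀ v₀ x₀ s₁ v₁ x₁ w y : Fin (2 * m)
    s₀ = cell r (1 + a)
    v₀ = cell r a
    x₀ = cell r (M + a)
    s₁ = cell r′ (2 + a)
    v₁ = cell r (2 + a)
    x₁ = cell r (3 + a)
    w  = cell r′ (1 + a)
    y  = cell r′ a

    threat₀ : Threat H (⁅ s₀ ⁆ ∪ ⊥) v₀ x₀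
    threat₀ u e with neighbours {u} r a (H⇒G e)
    ... | inj₁ refl        = contradiction e ¬H⁻
    ... | inj₂ (inj₁ refl) = inj₂ (∈-insert-self s₀)
    ... | inj₂ (inj₂ refl) = inj₁ refl

    threat₁ : Threat H (⁅ s₁ ⁆ ∪ (⁅ s₀ ⁆ ∪ ⊥)) v₁ x₁
    threat₁ u e with neighbours-suc {u} r (1 + a) (H⇒G e)
    ... | inj₁ refl        = inj₂ (∈-insert-self s₁)
    ... | inj₂ (inj₁ refl) = inj₁ refl
    ... | inj₂ (inj₂ refl) = inj₂ (∈-insert-old s₁ (∈-insert-self s₀))

    threatʷ : Threat H (⁅ s₁ ⁆ ∪ (⁅ s₀ ⁆ ∪ ⊥)) w y
    threatʷ u e with neighbours-suc {u} r′ a (H⇒G e)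
    ... | inj₁ refl rewrite opposite-involutive r = inj₂ (∈-insert-old s₁ (∈-insert-self s₀))
    ... | inj₂ (inj₁ refl) = inj₂ (∈-insert-self s₁)
    ... | inj₂ (inj₂ refl) = inj₁ refl

    -- Columns a + 3 and a − 1 differ because m ∤ 4.
    x₁≢x₀ : x₁ ≢ x₀
    x₁≢x₀ eq = odd∤4 K ([d+a]%m≡a%m⇒m∣d m 4 (M + a) (begin
      (4 + (M + a)) % m  ≡⟨ cong (λ z → suc z % m) shuffle ⟨
      (m + (3 + a)) % m  ≡⟨ [m+a]%m≡a%m (3 + a) ⟩
      (3 + a) % m        ≡⟨ cell-%-injective r r (3 + a) (M + a) eq ⟩
      (M + a) % m        ∎))
      where
      open ≡-Reasoning
      shuffle : M + (3 + a) ≡ 3 + (M + a)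
      shuffle = trans (sym (+-assoc M 3 a)) (cong (_+ a) (+-comm M 3))

  even-bound : ∀ {t} → t ≤ K → 2 + 2 * t < m
  even-bound {t} t≤K = s≤s (subst (2 + 2 * t ≤_) (sym (*-suc 2 K)) (+-monoʳ-≤ 2 (*-monoʳ-≤ 2 t≤K)))

  odd-bound : ∀ {t} → t ≤ K → 1 + 2 * t < m
  odd-bound {t} t≤K = <-trans (n<1+n (1 + 2 * t)) (even-bound t≤K)

  missing-step⇒¬IsD : ∀ {H} → H ⇒ G → ∀ r a →
                      ¬ H (cell r a) (cell r (1 + a)) → ¬ H (cell r (1 + a)) (cell r a) → ¬ IsD H
  missing-step⇒¬IsD {H} H⇒G r a ¬H ¬H⁻ =
    StallerStrategy⇒¬IsD H (ForcingChain⇒StallerStrategy H chain)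
    where
    r′ = opposite r

    s x v : ℕ → Fin (2 * m)
    s t = cell r  (2 + 2 * t + a)
    x t = cell r′ (1 + 2 * t + a)
    v t = cell r  (1 + 2 * t + a)

    s-distinct : ∀ {i j} → i < j → j ≤ K → s i ≢ s j
    s-distinct {i} {j} i<j j≤K eq = <⇒≢ i<j (*-cancelˡ-≡ i j 2 (suc-injective (suc-injective
      (cell-window r r (2 + 2 * i) (2 + 2 * j) a (even-bound (≤-trans (<⇒≤ i<j) j≤K)) (even-bound j≤K) eq))))

    x-distinct : ∀ {i j} → i < j → j ≤ K → x i ≢ x j
    x-distinct {i} {j} i<j j≤K eq = <⇒≢ i<j (*-cancelˡ-≡ i j 2 (suc-injective
      (cell-window r′ r′ (1 + 2 * i) (1 + 2 * j) a (odd-bound (≤-trans (<⇒≤ i<j) j≤K)) (odd-bound j≤K) eq)))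

    y≢x : ∀ {i} → i ≤ K → cell r′ a ≢ x i
    y≢x {i} i≤K eq with () ← cell-window r′ r′ 0 (1 + 2 * i) a (s≤s z≤n) (odd-bound i≤K) eq

    earlier : ∀ t {u} → u ≡ cell r (2 * t + a) → H u (v t) → u ≡ x t ⊎ ∃ λ i → i ≤ t × u ≡ s i
    earlier zero    refl e = contradiction e ¬H
    earlier (suc t) u≡   _ = inj₂ (t , n≤1+n t , trans u≡ (cong (λ z → cell r (z + a)) (*-suc 2 t)))

    threatᵛ : ∀ {t} → t ≤ K → ∀ u → H u (v t) → u ≡ x t ⊎ ∃ λ i → i ≤ t × u ≡ s i
    threatᵛ {t} _ u e with neighbours-suc {u} r (2 * t + a) (H⇒G e)
    ... | inj₁ u≡          = inj₁ u≡
    ... | inj₂ (inj₁ u≡)   = inj₂ (t , ≤-refl , u≡)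
    ... | inj₂ (inj₂ u≡)   = earlier t u≡ e

    threatʷ : ∀ u → H u (cell r a) → u ≡ cell r′ a ⊎ ∃ λ i → i ≤ K × u ≡ s i
    threatʷ u e with neighbours {u} r a (H⇒G e)
    ... | inj₁ u≡          = inj₁ u≡
    ... | inj₂ (inj₁ refl) = contradiction e ¬H⁻
    ... | inj₂ (inj₂ u≡)   = inj₂ (K , ≤-refl , trans u≡ (cong (λ z → cell r (z + a)) (*-suc 2 K)))

    chain : ForcingChain H K
    chain = record
      { s = s ; x = x ; v = v ; w = cell r a ; y = cell r′ a
      ; x≢s = λ i j → cell-rows-≢ (1 + 2 * i + a) (2 + 2 * j + a) (opposite-≢ r)
      ; s-distinct = s-distinct ; x-distinct = x-distinct ; y≢x = y≢x
      ; threatᵛ = threatᵛ ; threatʷ = threatʷ }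

  minimal : ∀ u v → G u v → ¬ IsD (removeEdge G u v)
  minimal u v e with edge-view {u} {v} e
  ... | rung-edge r a =
    missing-rung⇒¬IsD (removeEdge-⇒ G _ _) r a (removeEdge-removes G _ _) (removeEdge-removes⁻ G _ _)
  ... | forward r a =
    missing-step⇒¬IsD (removeEdge-⇒ G _ _) r a (removeEdge-removes G _ _) (removeEdge-removes⁻ G _ _)
  ... | backward r a =
    missing-step⇒¬IsD (removeEdge-⇒ G _ _) r a (removeEdge-removes⁻ G _ _) (removeEdge-removes G _ _)

K2-DMinimal : ∀ k → 2 ≤ k → DMinimal (K2 k)
K2-DMinimal k 2≤k = K2-connected k (≤-trans (s≤s z≤n) 2≤k)
                   , Pairing⇒IsD (K2 k) (K2-pairing k 2≤k)
                   , CompleteBipartite.K2-minimal k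

prism-DMinimal : ∀ k → 1 ≤ k → DMinimal (P2 □ Cycle (suc (2 * k)))
prism-DMinimal (suc K) _ = connected , Pairing⇒IsD G pairing , minimal
  where
  open Prism (suc K)
  open PrismMinimal K

proposition4p5 : ((k : ℕ) → 2 ≤ k → DMinimal (K2 k))
               × ((k : ℕ) → 1 ≤ k → DMinimal (P2 □ Cycle (suc (2 * k))))
proposition4p5 = K2-DMinimal , prism-DMinimal
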